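{- Let $S=(V,\mathcal{E})$ be the hypergraph with $V=\{0,1,\dots,6\}$ and $\mathcal{E}=\{\{0,i\}: i\in[6]\}\cup\{\{0,i,j\}: i,j\in[6],\ i\ne j\}$. Let $h_1,h_2$ be the orientations with $h_1(\{0,i\})=h_2(\{0,i\})=i$ for all $i\in[6]$, and $h_1(\{0,i,j\})=\min\{i,j\}$, $h_2(\{0,i,j\})=\max\{i,j\}$. Then the flip distance between $h_1$ and $h_2$ is $12$. However, any flip sequence from $h_1$ to $h_2$ in which no flipped pair contains the vertex $0$ has length at least $15$.
   Context: An orientation of a hypergraph $(V,\mathcal{E})$ is a map $h:\mathcal{E}\to V$ with $h(e)\in e$. Its digraph $D_h$ has vertex set $V$ and an arc $(u,v)$ iff some $e$ has $h(e)=v$ and $u\in e\setminus\{v\}$; $h$ is acyclic if $D_h$ is acyclic. For distinct acyclic orientations $h,h'$ and distinct $u,v$, $h'$ is obtained from $h$ by a flip at $(u,v)$ if $h'(e)=v$ for every $e\supseteq\{u,v\}$ with $h(e)=u$ and $h'(e)=h(e)$ otherwise; flipping the unordered pair $\{u,v\}$ means flipping at $(u,v)$ or $(v,u)$. A flip sequence is a sequence of such flips through acyclic orientations; the flip distance is the minimum length of a flip sequence. -}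

module Defs where

open import Data.Nat using (ℕ; _≤_)
open import Data.Fin using (Fin; zero; suc; _<_)
open import Data.Fin.Subset using (Subset; _∈_; ⁅_⁆; _∪_)
open import Data.Fin.Subset.Properties using (x∈⁅x⁆; x∈p∪q⁺)
open import Data.Product using (Σ; Σ-syntax; ∃; _×_; _,_)
open import Data.Sum using (_⊎_; inj₁; inj₂)
open import Data.List using (List; []; _∷_; length)
open import Data.List.Relation.Unary.All using (All)
open import Relation.Nullary using (¬_)
open import Relation.Binary.PropositionalEquality using (_≡_; _≢_)
open import Relation.Binary.Construct.Closure.Transitive using (TransClosure)

record Hypergraph : Set₁ where
  field
    n    : ℕ
    Ix   : Set
    edge : Ix → Subset n

module _ (H : Hypergraph) where
  open Hypergraph H

  record Orientation : Set where
    constructor orient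
    field
      head  : Ix → Fin n
      head∈ : ∀ k → head k ∈ edge k
  open Orientation public

  Arc : Orientation → Fin n → Fin n → Set
  Arc h u v = Σ[ k ∈ Ix ] (head h k ≡ v × u ∈ edge k × u ≢ v)

  Acyclic : Orientation → Set
  Acyclic h = ∀ u → ¬ TransClosure (Arc h) u u

  Distinct : Orientation → Orientation → Set
  Distinct h h' = Σ[ k ∈ Ix ] (head h k ≢ head h' k)

  FlipAt : Orientation → Orientation → Fin n → Fin n → Set
  FlipAt h h' u v =
    Acyclic h × Acyclic h' × Distinct h h' × u ≢ v ×
    (∀ k → ((u ∈ edge k × v ∈ edge k × head h k ≡ u) → head h' k ≡ v)
         × (¬ (u ∈ edge k × v ∈ edge k × head h k ≡ u) → head h' k ≡ head h k))

  data FlipSeq : Orientation → Orientation → List (Fin n × Fin n) → Set where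
    done : ∀ {h} → Acyclic h → FlipSeq h h []
    step : ∀ {h h' h'' u v ps} → FlipAt h h' u v → FlipSeq h' h'' ps →
           FlipSeq h h'' ((u , v) ∷ ps)

  FlipDistance : Orientation → Orientation → ℕ → Set
  FlipDistance h h' d =
    (Σ[ ps ∈ List (Fin n × Fin n) ] (FlipSeq h h' ps × length ps ≡ d))
    × (∀ ps → FlipSeq h h' ps → d ≤ length ps)

-- The hypergraph S: V = {0,…,6}; vertex i ∈ [6] is suc i' with i' : Fin 6.
-- Edges: {0,i} for i ∈ [6] (inj₁ i), and {0,i,j} for i ≠ j, indexed by
-- the unordered pair given as i < j (inj₂).

SIx : Set
SIx = Fin 6 ⊎ Σ[ p ∈ Fin 6 × Fin 6 ] (Data.Product.proj₁ p < Data.Product.proj₂ p)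

Sedge : SIx → Subset 7
Sedge (inj₁ i)             = ⁅ zero ⁆ ∪ ⁅ suc i ⁆
Sedge (inj₂ ((i , j) , _)) = ⁅ zero ⁆ ∪ (⁅ suc i ⁆ ∪ ⁅ suc j ⁆)

S : Hypergraph
S = record { n = 7 ; Ix = SIx ; edge = Sedge }

h₁ : Orientation S
h₁ = orient hd pf
  where
  hd : SIx → Fin 7
  hd (inj₁ i)             = suc i
  hd (inj₂ ((i , j) , _)) = suc i
  pf : ∀ k → hd k ∈ Sedge k
  pf (inj₁ i)             = x∈p∪q⁺ {p = ⁅ zero ⁆} (inj₂ (x∈⁅x⁆ (suc i)))
  pf (inj₂ ((i , j) , _)) = x∈p∪q⁺ {p = ⁅ zero ⁆} (inj₂ (x∈p∪q⁺ {q = ⁅ suc j ⁆} (inj₁ (x∈⁅x⁆ (suc i)))))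

h₂ : Orientation S
h₂ = orient hd pf
  where
  hd : SIx → Fin 7
  hd (inj₁ i)             = suc i
  hd (inj₂ ((i , j) , _)) = suc j
  pf : ∀ k → hd k ∈ Sedge k
  pf (inj₁ i)             = x∈p∪q⁺ {p = ⁅ zero ⁆} (inj₂ (x∈⁅x⁆ (suc i)))
  pf (inj₂ ((i , j) , _)) = x∈p∪q⁺ {p = ⁅ zero ⁆} (inj₂ (x∈p∪q⁺ {p = ⁅ suc i ⁆} (inj₂ (x∈⁅x⁆ (suc j)))))

Avoids0 : Fin 7 × Fin 7 → Set
Avoids0 (u , v) = u ≢ zero × v ≢ zero

-- Lower bound: charge each flip to the unordered pair it flips.  The head of a spoke {0,i} is i
-- at both ends and every flip of {0,i} reverses it, so each spoke is flipped an even number of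
-- times.  For i < j the head of the triangle {0,i,j} must leave i (a flip of {0,i} or {i,j}) and
-- reach j (a flip of {0,j} or {i,j}), so {i,j} is flipped unless both spokes are.  With t spokes
-- flipped this forces at least 2t + 15 - C(t,2) flips, which is at least 12, and 15 when t = 0,
-- i.e. when no flip involves 0.
--
-- Upper bound: the orientation induced by a linear order of the vertices (each edge headed by
-- its latest vertex) is acyclic.  Raising 0 from the bottom to the top of 0 < 6 < 5 < ... < 1
-- and then lifting 6, 5, ..., 1 back over it, one at a time, reaches 0 < 1 < ... < 6 in twelve
-- flips, each of a single spoke.

module Submission where

open import Defs
open import Data.Nat using (_≤_)
open import Data.Product using (_×_)
open import Data.List using (length)
open import Data.List.Relation.Unary.All using (All)

open import Data.Bool using (Bool; true; false; _∧_; if_then_else_)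
open import Data.Fin using (Fin; zero; suc; #_) renaming (_<_ to _<ᶠ_)
open import Data.Fin.Properties using (_≟_; all?; <-irrelevant; <⇒≢; suc-injective)
  renaming (_<?_ to _<ᶠ?_)
open import Data.Fin.Subset using (Subset; _∈_; ⁅_⁆; _∪_)
open import Data.Fin.Subset.Properties
  using (_∈?_; x∈⁅x⁆; x∈p∪q⁺; x∈p∪q⁻; x∈⁅y⁆⇒x≡y; anySubset?)
open import Data.List using (List; []; _∷_; [_]; map; filter; _++_; mapMaybe; cartesianProduct; allFin)
open import Data.List.Properties
  using (filter-++; length-++; filter-some; filter-accept; filter-reject; map-cong)
import Data.List.Relation.Unary.All as All
open import Data.List.Relation.Unary.All.Properties using (All¬⇒¬Any)
open import Data.List.Relation.Unary.Any as Any using (Any; here; there; any?)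
open import Data.List.Relation.Unary.Any.Properties using (Any-⊎⁻)
open import Data.Nat using (ℕ; zero; suc; parity; _+_; _<_; _<ᵇ_; z≤n; s≤s; _≤?_; _<?_)
open import Data.Maybe as Maybe using (Maybe)
open import Data.Nat.ListAction using (sum)
open import Data.Nat.Properties
  using (module ≤-Reasoning; +-commutativeSemigroup; ≤-trans; ≤-reflexive; ≤-refl; <-trans; <-irrefl;
         ≮⇒≥; +-mono-≤)
open import Algebra.Properties.CommutativeSemigroup +-commutativeSemigroup using (interchange)
open import Data.Parity as ℙ using (Parity; 0ℙ; 1ℙ; _⁻¹)
open import Data.Parity.Properties using (+-assoc; +-comm; +-cancelʳ-≡; +-homo-+)
open import Data.Product using (Σ-syntax; ∃; _,_; proj₁; proj₂)
open import Data.Sum as Sum using (_⊎_; inj₁; inj₂)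
open import Data.Vec using (lookup; tabulate)
open import Data.Vec.Properties using (lookup∘tabulate)
open import Function using (_∘_; _$_)
open import Relation.Binary.Construct.Closure.Transitive using (TransClosure)
  renaming ([_] to [_]⁺; _∷_ to _∷⁺_)
open import Relation.Binary.PropositionalEquality
  using (_≡_; _≢_; refl; sym; trans; cong; subst; module ≡-Reasoning)
open import Relation.Nullary using (¬_; Dec; yes; no; does; contradiction)
open import Relation.Nullary.Decidable
  using (True; toWitness; from-yes; from-no; map′; ¬?; _×-dec_; _→-dec_; _⊎-dec_; dec-true; dec-false;
         dec⇒maybe)
open import Relation.Unary using (Decidable)

count : ∀ {A : Set} {P : A → Set} → Decidable P → List A → ℕ
count P? xs = length (filter P? xs)

count-accept : ∀ {A : Set} {P : A → Set} (P? : Decidable P) {x} → P x → count P? [ x ] ≡ 1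
count-accept P? px = cong length (filter-accept P? px)

count-reject : ∀ {A : Set} {P : A → Set} (P? : Decidable P) {x} → ¬ P x → count P? [ x ] ≡ 0
count-reject P? ¬px = cong length (filter-reject P? ¬px)

count-∷ : ∀ {A : Set} {P : A → Set} (P? : Decidable P) x xs →
          count P? (x ∷ xs) ≡ count P? [ x ] + count P? xs
count-∷ P? x xs = trans (cong length (filter-++ P? [ x ] xs)) (length-++ (filter P? [ x ]))

module _ {C : Set} where
  sum-map-+ : ∀ (f g : C → ℕ) cs → sum (map (λ c → f c + g c) cs) ≡ sum (map f cs) + sum (map g cs)
  sum-map-+ f g []       = refl
  sum-map-+ f g (c ∷ cs) rewrite sum-map-+ f g cs = interchange (f c) (g c) _ _

  sum-map-mono : ∀ {f g : C → ℕ} → (∀ c → f c ≤ g c) → ∀ cs → sum (map f cs) ≤ sum (map g cs)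
  sum-map-mono f≤g []       = z≤n
  sum-map-mono f≤g (c ∷ cs) = +-mono-≤ (f≤g c) (sum-map-mono f≤g cs)

  sum-map-cong : ∀ {f g : C → ℕ} → (∀ c → f c ≡ g c) → ∀ cs → sum (map f cs) ≡ sum (map g cs)
  sum-map-cong f≗g cs = cong sum (map-cong f≗g cs)

sum-count≤length : ∀ {A C : Set} {P : C → A → Set} (P? : ∀ c → Decidable (P c)) cs →
                   (∀ x → sum (map (λ c → count (P? c) [ x ]) cs) ≤ 1) →
                   ∀ xs → sum (map (λ c → count (P? c) xs) cs) ≤ length xs
sum-count≤length P? cs counted-once [] = ≤-reflexive (zeros cs)
  where
  zeros : ∀ cs → sum (map (λ c → count (P? c) []) cs) ≡ 0
  zeros []       = refl
  zeros (_ ∷ cs) = zeros cs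
sum-count≤length P? cs counted-once (x ∷ xs) = begin
  sum (map (λ c → count (P? c) (x ∷ xs)) cs)
    ≡⟨ sum-map-cong (λ c → count-∷ (P? c) x xs) cs ⟩
  sum (map (λ c → count (P? c) [ x ] + count (P? c) xs) cs)
    ≡⟨ sum-map-+ (λ c → count (P? c) [ x ]) (λ c → count (P? c) xs) cs ⟩
  sum (map (λ c → count (P? c) [ x ]) cs) + sum (map (λ c → count (P? c) xs) cs)
    ≤⟨ +-mono-≤ (counted-once x) (sum-count≤length P? cs counted-once xs) ⟩
  1 + length xs ∎
  where open ≤-Reasoning

SamePair : ∀ {A : Set} → A × A → A × A → Set
SamePair (a , b) (u , v) = (u ≡ a × v ≡ b) ⊎ (u ≡ b × v ≡ a)

samePair? : ∀ {n} (p : Fin n × Fin n) → Decidable (SamePair p)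
samePair? (a , b) (u , v) = (u ≟ a ×-dec v ≟ b) ⊎-dec (u ≟ b ×-dec v ≟ a)

module _ {H : Hypergraph} where
  open Hypergraph H

  Redirects : Orientation H → Fin n → Fin n → Ix → Set
  Redirects h u v k = u ∈ edge k × v ∈ edge k × head h k ≡ u

  redirects? : ∀ h u v k → Dec (Redirects h u v k)
  redirects? h u v k = u ∈? edge k ×-dec v ∈? edge k ×-dec head h k ≟ u

  FlipRule : Orientation H → Orientation H → Fin n → Fin n → Set
  FlipRule h h' u v =
    ∀ k → (Redirects h u v k → head h' k ≡ v) × (¬ Redirects h u v k → head h' k ≡ head h k)

  HeadsMaximal : (Fin n → ℕ) → Orientation H → Set
  HeadsMaximal r h = ∀ k u → u ∈ edge k → u ≢ head h k → r u < r (head h k)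

  acyclic-if-headsMaximal : ∀ {h} r → HeadsMaximal r h → Acyclic H h
  acyclic-if-headsMaximal {h} r maximal u cycle = <-irrefl refl (rank-increases cycle)
    where
    rank-increases : ∀ {u v} → TransClosure (Arc H h) u v → r u < r v
    rank-increases [ k , refl , u∈ , u≢ ]⁺        = maximal k _ u∈ u≢
    rank-increases ((k , refl , u∈ , u≢) ∷⁺ arcs) = <-trans (maximal k _ u∈ u≢) (rank-increases arcs)

  flipAt-intro : ∀ {h h' u v k} → Acyclic H h → Acyclic H h' → u ≢ v →
                 Redirects h u v k → FlipRule h h' u v → FlipAt H h h' u v
  flipAt-intro {k = k} acyclic acyclic' u≢v r@(_ , _ , hk≡u) rule =
    acyclic , acyclic' , (k , λ same → u≢v (trans (sym hk≡u) (trans same (proj₁ (rule k) r))))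
    , u≢v , rule

  module Flip {h h' u v} (f : FlipAt H h h' u v) where
    flip-endpoints-≢ : u ≢ v
    flip-endpoints-≢ = proj₁ (proj₂ (proj₂ (proj₂ f)))

    redirected-head : ∀ k → Redirects h u v k → head h' k ≡ v
    redirected-head k = proj₁ (proj₂ (proj₂ (proj₂ (proj₂ f))) k)

    unredirected-head : ∀ k → ¬ Redirects h u v k → head h' k ≡ head h k
    unredirected-head k = proj₂ (proj₂ (proj₂ (proj₂ (proj₂ f))) k)

    redirected-edge : ∃ (Redirects h u v)
    redirected-edge with proj₁ (proj₂ (proj₂ f))
    ... | k , moved with redirects? h u v k
    ...   | yes r  = k , r
    ...   | no ¬r = contradiction (sym (unredirected-head k ¬r)) moved

    -- The redirected edge gives an arc v → u, so an edge headed by v through u would close a 2-cycle.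
    flip-target-not-head : ∀ k → u ∈ edge k → v ∈ edge k → head h k ≢ v
    flip-target-not-head k u∈ v∈ hk≡v with k' , _ , v∈' , hk'≡u ← redirected-edge =
      proj₁ f _ ((k , hk≡v , u∈ , flip-endpoints-≢)
                 ∷⁺ [ k' , hk'≡u , v∈' , flip-endpoints-≢ ∘ sym ]⁺)

    flip-reverses : ∀ k → u ∈ edge k → v ∈ edge k →
                    head h k ≡ u ⊎ head h k ≡ v → head h k ≡ u × head h' k ≡ v
    flip-reverses k u∈ v∈ (inj₁ hk≡u) = hk≡u , redirected-head k (u∈ , v∈ , hk≡u)
    flip-reverses k u∈ v∈ (inj₂ hk≡v) = contradiction hk≡v (flip-target-not-head k u∈ v∈)

  Departs : Fin n → Ix → Fin n × Fin n → Set
  Departs x k (u , v) = u ≡ x × v ∈ edge k × u ≢ v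

  Enters : Fin n → Ix → Fin n × Fin n → Set
  Enters y k (u , v) = v ≡ y × u ∈ edge k × u ≢ v

  head-departs : ∀ {h h'' ps} k → FlipSeq H h h'' ps → head h k ≢ head h'' k →
                 Any (Departs (head h k) k) ps
  head-departs k (done _) moved = contradiction refl moved
  head-departs {h} k (step {h' = h'} {u = u} {v} {ps} f seq) moved = departs (redirects? h u v k)
    where
    open Flip {h} {h'} f
    departs : Dec (Redirects h u v k) → Any (Departs (head h k) k) ((u , v) ∷ ps)
    departs (yes (_ , v∈ , hk≡u)) = here (sym hk≡u , v∈ , flip-endpoints-≢)
    departs (no ¬r) = there (subst (λ x → Any (Departs x k) ps) kept
                                   (head-departs k seq (moved ∘ trans (sym kept))))
      where
      kept : head h' k ≡ head h k
      kept = unredirected-head k ¬r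

  head-enters : ∀ {h h'' ps} k → FlipSeq H h h'' ps → head h k ≢ head h'' k →
                Any (Enters (head h'' k) k) ps
  head-enters k (done _) moved = contradiction refl moved
  head-enters {h} {h''} k (step {h' = h'} {u = u} {v} {ps} f seq) moved =
    enters (head h' k ≟ head h'' k) (redirects? h u v k)
    where
    open Flip {h} {h'} f
    enters : Dec (head h' k ≡ head h'' k) → Dec (Redirects h u v k) →
             Any (Enters (head h'' k) k) ((u , v) ∷ ps)
    enters (no moved') _ = there (head-enters k seq moved')
    enters (yes arrived) (yes r@(u∈ , _ , _)) =
      here (trans (sym (redirected-head k r)) arrived , u∈ , flip-endpoints-≢)
    enters (yes arrived) (no ¬r) = contradiction (trans (sym (unredirected-head k ¬r)) arrived) moved

  module TwoVertexEdge (k : Ix) {a b : Fin n} (a∈ : a ∈ edge k) (b∈ : b ∈ edge k)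
                       (a-or-b : ∀ {w} → w ∈ edge k → w ≡ a ⊎ w ≡ b) where
    open ≡-Reasoning

    ab? : Decidable (SamePair (a , b))
    ab? = samePair? (a , b)

    sideOf : Fin n → Parity
    sideOf w = if does (w ≟ a) then 0ℙ else 1ℙ

    side : Orientation H → Parity
    side h = sideOf (head h k)

    sideOf-a : sideOf a ≡ 0ℙ
    sideOf-a rewrite dec-true (a ≟ a) refl = refl

    sideOf-b : b ≢ a → sideOf b ≡ 1ℙ
    sideOf-b b≢a rewrite dec-false (b ≟ a) b≢a = refl

    same-pair-if-members : ∀ {u v} → u ∈ edge k → v ∈ edge k → u ≢ v → SamePair (a , b) (u , v)
    same-pair-if-members u∈ v∈ u≢v with a-or-b u∈ | a-or-b v∈
    ... | inj₁ u≡a | inj₁ v≡a = contradiction (trans u≡a (sym v≡a)) u≢v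
    ... | inj₁ u≡a | inj₂ v≡b = inj₁ (u≡a , v≡b)
    ... | inj₂ u≡b | inj₁ v≡a = inj₂ (u≡b , v≡a)
    ... | inj₂ u≡b | inj₂ v≡b = contradiction (trans u≡b (sym v≡b)) u≢v

    side-across : ∀ {h h' u v} → FlipAt H h h' u v → SamePair (a , b) (u , v) → side h' ≡ side h ⁻¹
    side-across {h} {h'} f (inj₁ (refl , refl)) = begin
      side h'          ≡⟨ cong sideOf (proj₂ heads) ⟩
      sideOf b         ≡⟨ sideOf-b (flip-endpoints-≢ ∘ sym) ⟩
      1ℙ               ≡⟨ cong _⁻¹ (trans (cong sideOf (proj₁ heads)) sideOf-a) ⟨
      side h ⁻¹        ∎
      where
      open Flip {h} {h'} f
      heads : head h k ≡ a × head h' k ≡ b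
      heads = flip-reverses k a∈ b∈ (a-or-b (head∈ h k))
    side-across {h} {h'} f (inj₂ (refl , refl)) = begin
      side h'          ≡⟨ cong sideOf (proj₂ heads) ⟩
      sideOf a         ≡⟨ sideOf-a ⟩
      0ℙ               ≡⟨ cong _⁻¹ (trans (cong sideOf (proj₁ heads)) (sideOf-b flip-endpoints-≢)) ⟨
      side h ⁻¹        ∎
      where
      open Flip {h} {h'} f
      heads : head h k ≡ b × head h' k ≡ a
      heads = flip-reverses k b∈ a∈ (Sum.swap (a-or-b (head∈ h k)))

    side-outside : ∀ {h h' u v} → FlipAt H h h' u v → ¬ SamePair (a , b) (u , v) → side h' ≡ side h
    side-outside {h} {h'} {u} {v} f different = cong sideOf (unredirected-head k (different ∘ redirected-pair))
      where
      open Flip {h} {h'} f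
      redirected-pair : Redirects h u v k → SamePair (a , b) (u , v)
      redirected-pair (u∈ , v∈ , _) = same-pair-if-members u∈ v∈ flip-endpoints-≢

    side-flip : ∀ {h h' u v} → FlipAt H h h' u v →
                side h' ≡ parity (count ab? [ (u , v) ]) ℙ.+ side h
    side-flip {h} {h'} {u} {v} f with ab? (u , v)
    ... | yes same = trans (side-across {h} {h'} f same)
                           (cong (λ m → parity m ℙ.+ side h) (sym (count-accept ab? same)))
    ... | no different = trans (side-outside {h} {h'} f different)
                               (cong (λ m → parity m ℙ.+ side h) (sym (count-reject ab? different)))

    side-along : ∀ {h h'' ps} → FlipSeq H h h'' ps →
                 side h'' ≡ parity (count ab? ps) ℙ.+ side h
    side-along (done _) = refl
    side-along {h} {h''} (step {h' = h'} {u = u} {v} {ps} f seq) = begin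
      side h''                                     ≡⟨ side-along seq ⟩
      parity c ℙ.+ side h'                ≡⟨ cong (parity c ℙ.+_) (side-flip {h} {h'} f) ⟩
      parity c ℙ.+ (parity c₁ ℙ.+ side h) ≡⟨ +-assoc (parity c) (parity c₁) (side h) ⟨
      parity c ℙ.+ parity c₁ ℙ.+ side h   ≡⟨ cong (ℙ._+ side h) (+-comm (parity c) (parity c₁)) ⟩
      parity c₁ ℙ.+ parity c ℙ.+ side h   ≡⟨ cong (ℙ._+ side h) (+-homo-+ c₁ c) ⟨
      parity (c₁ + c) ℙ.+ side h          ≡⟨ cong (λ m → parity m ℙ.+ side h) (count-∷ ab? (u , v) ps) ⟨
      parity (count ab? ((u , v) ∷ ps)) ℙ.+ side h ∎
      where
      c c₁ : ℕ
      c  = count ab? ps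
      c₁ = count ab? [ (u , v) ]

    head-returns⇒even-flips : ∀ {h h'' ps} → FlipSeq H h h'' ps → head h'' k ≡ head h k →
                              parity (count ab? ps) ≡ 0ℙ
    head-returns⇒even-flips {h} seq returned =
      +-cancelʳ-≡ (side h) _ 0ℙ (trans (sym (side-along seq)) (cong sideOf returned))

zero∈ : ∀ k → zero ∈ Sedge k
zero∈ (inj₁ i)             = x∈p∪q⁺ {q = ⁅ suc i ⁆} (inj₁ (x∈⁅x⁆ zero))
zero∈ (inj₂ ((i , j) , _)) = x∈p∪q⁺ {q = ⁅ suc i ⁆ ∪ ⁅ suc j ⁆} (inj₁ (x∈⁅x⁆ zero))

leaf∈spoke : ∀ i → suc i ∈ Sedge (inj₁ i)
leaf∈spoke i = x∈p∪q⁺ {p = ⁅ zero ⁆} (inj₂ (x∈⁅x⁆ (suc i)))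

left∈triangle : ∀ {i j} (i<j : i <ᶠ j) → suc i ∈ Sedge (inj₂ ((i , j) , i<j))
left∈triangle {i} {j} _ =
  x∈p∪q⁺ {p = ⁅ zero ⁆} (inj₂ (x∈p∪q⁺ {q = ⁅ suc j ⁆} (inj₁ (x∈⁅x⁆ (suc i)))))

right∈triangle : ∀ {i j} (i<j : i <ᶠ j) → suc j ∈ Sedge (inj₂ ((i , j) , i<j))
right∈triangle {i} {j} _ =
  x∈p∪q⁺ {p = ⁅ zero ⁆} (inj₂ (x∈p∪q⁺ {p = ⁅ suc i ⁆} (inj₂ (x∈⁅x⁆ (suc j)))))

spoke-members : ∀ {w} i → w ∈ Sedge (inj₁ i) → w ≡ zero ⊎ w ≡ suc i
spoke-members i w∈ = Sum.map (x∈⁅y⁆⇒x≡y _) (x∈⁅y⁆⇒x≡y _) (x∈p∪q⁻ ⁅ zero ⁆ ⁅ suc i ⁆ w∈)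

triangle-members : ∀ {w i j} (i<j : i <ᶠ j) → w ∈ Sedge (inj₂ ((i , j) , i<j)) →
                   w ≡ zero ⊎ w ≡ suc i ⊎ w ≡ suc j
triangle-members {i = i} {j} _ w∈ =
  Sum.map (x∈⁅y⁆⇒x≡y _) (Sum.map (x∈⁅y⁆⇒x≡y _) (x∈⁅y⁆⇒x≡y _) ∘ x∈p∪q⁻ ⁅ suc i ⁆ ⁅ suc j ⁆)
          (x∈p∪q⁻ ⁅ zero ⁆ (⁅ suc i ⁆ ∪ ⁅ suc j ⁆) w∈)

spoke : Fin 6 → Fin 7 × Fin 7
spoke i = zero , suc i

rim : Fin 6 → Fin 6 → Fin 7 × Fin 7
rim i j = suc i , suc j

pairOf : SIx → Fin 7 × Fin 7
pairOf (inj₁ i)             = spoke i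
pairOf (inj₂ ((i , j) , _)) = rim i j

flipsOf : SIx → List (Fin 7 × Fin 7) → ℕ
flipsOf k = count (samePair? (pairOf k))

edges : List SIx
edges = map inj₁ (allFin 6) ++ mapMaybe triangle (cartesianProduct (allFin 6) (allFin 6))
  where
  triangle : Fin 6 × Fin 6 → Maybe SIx
  triangle (i , j) = Maybe.map (λ i<j → inj₂ ((i , j) , i<j)) (dec⇒maybe (i <ᶠ? j))

flips-counted-once : ∀ x → sum (map (λ k → flipsOf k [ x ]) edges) ≤ 1
flips-counted-once (u , v) =
  from-yes (all? λ u → all? λ v → sum (map (λ k → flipsOf k [ (u , v) ]) edges) ≤? 1) u v

touched : List (Fin 7 × Fin 7) → Fin 6 → Bool
touched ps i = does (any? (samePair? (spoke i)) ps)

minFlips : (Fin 6 → Bool) → SIx → ℕ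
minFlips z (inj₁ i)             = if z i then 2 else 0
minFlips z (inj₂ ((i , j) , _)) = if z i ∧ z j then 0 else 1

minTotal : (Fin 6 → Bool) → ℕ
minTotal z = sum (map (minFlips z) edges)

minTotal-cong : ∀ {z z'} → (∀ i → z i ≡ z' i) → minTotal z ≡ minTotal z'
minTotal-cong {z} {z'} z≗z' = sum-map-cong minFlips-cong edges
  where
  minFlips-cong : ∀ k → minFlips z k ≡ minFlips z' k
  minFlips-cong (inj₁ i) rewrite z≗z' i = refl
  minFlips-cong (inj₂ ((i , j) , _)) rewrite z≗z' i | z≗z' j = refl

minTotal≥12 : ∀ z → 12 ≤ minTotal z
minTotal≥12 z =
  subst (12 ≤_) (minTotal-cong (lookup∘tabulate z))
        (≮⇒≥ (λ below → no-small-subset (tabulate z , below)))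
  where
  no-small-subset : ¬ ∃ λ (T : Subset 6) → minTotal (lookup T) < 12
  no-small-subset = from-no (anySubset? λ T → minTotal (lookup T) <? 12)

minTotal-untouched : ∀ {z} → (∀ i → z i ≡ false) → minTotal z ≡ 15
minTotal-untouched untouched = minTotal-cong untouched

even-positive⇒≥2 : ∀ {c} → 0 < c → parity c ≡ 0ℙ → 2 ≤ c
even-positive⇒≥2 {suc (suc _)} _ _ = s≤s (s≤s z≤n)

module _ {ps} (seq : FlipSeq S h₁ h₂ ps) where
  spoke-flips-even : ∀ i → parity (flipsOf (inj₁ i) ps) ≡ 0ℙ
  spoke-flips-even i =
    TwoVertexEdge.head-returns⇒even-flips {S} (inj₁ i) (zero∈ (inj₁ i)) (leaf∈spoke i) (spoke-members i)
                                          seq refl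

  rim-unflipped⇒spokes-flipped : ∀ {i j} (i<j : i <ᶠ j) → ¬ Any (SamePair (rim i j)) ps →
                                 Any (SamePair (spoke i)) ps × Any (SamePair (spoke j)) ps
  rim-unflipped⇒spokes-flipped {i} {j} i<j unflipped =
      discard-rim (Any.map departure (head-departs k seq moved))
    , discard-rim (Any.map entry (head-enters k seq moved))
    where
    k : SIx
    k = inj₂ ((i , j) , i<j)
    moved : suc i ≢ suc j
    moved = <⇒≢ i<j ∘ suc-injective
    discard-rim : ∀ {Q : Fin 7 × Fin 7 → Set} → Any (λ x → Q x ⊎ SamePair (rim i j) x) ps → Any Q ps
    discard-rim = Sum.fromInj₁ (λ rim-flipped → contradiction rim-flipped unflipped) ∘ Any-⊎⁻
    departure : ∀ {x} → Departs {S} (suc i) k x → SamePair (spoke i) x ⊎ SamePair (rim i j) x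
    departure (u≡i , v∈ , u≢v) with triangle-members i<j v∈
    ... | inj₁ v≡0        = inj₁ (inj₂ (u≡i , v≡0))
    ... | inj₂ (inj₁ v≡i) = contradiction (trans u≡i (sym v≡i)) u≢v
    ... | inj₂ (inj₂ v≡j) = inj₂ (inj₁ (u≡i , v≡j))
    entry : ∀ {x} → Enters {S} (suc j) k x → SamePair (spoke j) x ⊎ SamePair (rim i j) x
    entry (v≡j , u∈ , u≢v) with triangle-members i<j u∈
    ... | inj₁ u≡0        = inj₁ (inj₁ (u≡0 , v≡j))
    ... | inj₂ (inj₁ u≡i) = inj₂ (inj₁ (u≡i , v≡j))
    ... | inj₂ (inj₂ u≡j) = contradiction (trans u≡j (sym v≡j)) u≢v

  minFlips≤flips : ∀ k → minFlips (touched ps) k ≤ flipsOf k ps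
  minFlips≤flips (inj₁ i) with any? (samePair? (spoke i)) ps
  ... | yes flipped = even-positive⇒≥2 (filter-some (samePair? (spoke i)) flipped) (spoke-flips-even i)
  ... | no _        = z≤n
  minFlips≤flips (inj₂ ((i , j) , i<j)) with any? (samePair? (rim i j)) ps
  ... | yes flipped =
    ≤-trans (at-most-1 (touched ps i ∧ touched ps j)) (filter-some (samePair? (rim i j)) flipped)
    where
    at-most-1 : ∀ b → (if b then 0 else 1) ≤ 1
    at-most-1 true  = z≤n
    at-most-1 false = ≤-refl
  ... | no unflipped
    with spoke-i , spoke-j ← rim-unflipped⇒spokes-flipped i<j unflipped
    rewrite dec-true (any? (samePair? (spoke i)) ps) spoke-i
          | dec-true (any? (samePair? (spoke j)) ps) spoke-j = z≤n

  minTotal≤length : minTotal (touched ps) ≤ length ps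
  minTotal≤length = ≤-trans (sum-map-mono minFlips≤flips edges)
                            (sum-count≤length (samePair? ∘ pairOf) edges flips-counted-once ps)

untouched-if-avoids0 : ∀ {ps} → All Avoids0 ps → ∀ i → touched ps i ≡ false
untouched-if-avoids0 {ps} avoids i =
  dec-false (any? (samePair? (spoke i)) ps) (All¬⇒¬Any (All.map not-spoke avoids))
  where
  not-spoke : ∀ {x} → Avoids0 x → ¬ SamePair (spoke i) x
  not-spoke (u≢0 , _) (inj₁ (u≡0 , _)) = u≢0 u≡0
  not-spoke (_ , v≢0) (inj₂ (_ , v≡0)) = v≢0 v≡0

∀-edge? : ∀ {P : SIx → Set} → (∀ k → Dec (P k)) → Dec (∀ k → P k)
∀-edge? {P} P? = map′ join split (all? (P? ∘ inj₁) ×-dec all? λ i → all? λ j → triangle? i j)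
  where
  triangle? : ∀ i j → Dec (∀ i<j → P (inj₂ ((i , j) , i<j)))
  triangle? i j with i <ᶠ? j
  ... | yes i<j = map′ (λ Pk i<j' → subst (λ i<j → P (inj₂ ((i , j) , i<j))) (<-irrelevant i<j i<j') Pk)
                       (λ all → all i<j) (P? (inj₂ ((i , j) , i<j)))
  ... | no i≮j  = yes (λ i<j → contradiction i<j i≮j)
  join : (∀ i → P (inj₁ i)) × (∀ i j i<j → P (inj₂ ((i , j) , i<j))) → ∀ k → P k
  join (spokes , _)    (inj₁ i)               = spokes i
  join (_ , triangles) (inj₂ ((i , j) , i<j)) = triangles i j i<j
  split : (∀ k → P k) → (∀ i → P (inj₁ i)) × (∀ i j i<j → P (inj₂ ((i , j) , i<j)))
  split all = all ∘ inj₁ , λ i j i<j → all (inj₂ ((i , j) , i<j))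

headsMaximal? : ∀ (r : Fin 7 → ℕ) (h : Orientation S) → Dec (HeadsMaximal r h)
headsMaximal? r h =
  ∀-edge? λ k → all? λ u → u ∈? Sedge k →-dec ¬? (u ≟ head h k) →-dec r u <? r (head h k)

flipRule? : ∀ (h h' : Orientation S) u v → Dec (FlipRule h h' u v)
flipRule? h h' u v = ∀-edge? λ k →
  (redirects? h u v k →-dec head h' k ≟ v) ×-dec (¬? (redirects? h u v k) →-dec head h' k ≟ head h k)

position : ∀ {n} → List (Fin n) → Fin n → ℕ
position []       w = 0
position (x ∷ xs) w = if does (x ≟ w) then 0 else suc (position xs w)

later : ∀ {n} → List (Fin n) → Fin n → Fin n → Fin n
later o a b = if position o a <ᵇ position o b then b else a

later-preserves : ∀ {n} {P : Fin n → Set} o {a b} → P a → P b → P (later o a b)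
later-preserves o {a} {b} pa pb with position o a <ᵇ position o b
... | true  = pb
... | false = pa

induced : List (Fin 7) → Orientation S
induced o = orient hd hd∈
  where
  hd : SIx → Fin 7
  hd (inj₁ i)             = later o zero (suc i)
  hd (inj₂ ((i , j) , _)) = later o (later o zero (suc i)) (suc j)
  hd∈ : ∀ k → hd k ∈ Sedge k
  hd∈ (inj₁ i)               = later-preserves {P = _∈ Sedge (inj₁ i)} o (zero∈ (inj₁ i)) (leaf∈spoke i)
  hd∈ k@(inj₂ ((i , j) , i<j)) = later-preserves {P = _∈ Sedge k} o
    (later-preserves {P = _∈ Sedge k} o (zero∈ k) (left∈triangle i<j)) (right∈triangle i<j)

checked-acyclic : ∀ (h : Orientation S) o → {True (headsMaximal? (position o) h)} → Acyclic S h
checked-acyclic h o {maximal} = acyclic-if-headsMaximal {h = h} (position o) (toWitness maximal)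

checked-step : ∀ {h'' ps} (h h' : Orientation S) o o' u v k →
               {True (headsMaximal? (position o) h)} → {True (headsMaximal? (position o') h')} →
               {True (¬? (u ≟ v))} → {True (redirects? h u v k)} → {True (flipRule? h h' u v)} →
               FlipSeq S h' h'' ps → FlipSeq S h h'' ((u , v) ∷ ps)
checked-step h h' o o' u v k {maximal} {maximal'} {u≢v} {redirected} {rule} =
  step {h' = h'} (flipAt-intro {h = h} {h'} {u} {v} {k}
                   (checked-acyclic h o {maximal}) (checked-acyclic h' o' {maximal'})
                   (toWitness u≢v) (toWitness redirected) (toWitness rule))

o₀ o₁ o₂ o₃ o₄ o₅ o₆ o₇ o₈ o₉ o₁₀ o₁₁ o₁₂ : List (Fin 7)
o₀  = # 0 ∷ # 6 ∷ # 5 ∷ # 4 ∷ # 3 ∷ # 2 ∷ # 1 ∷ []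
o₁  = # 6 ∷ # 0 ∷ # 5 ∷ # 4 ∷ # 3 ∷ # 2 ∷ # 1 ∷ []
o₂  = # 6 ∷ # 5 ∷ # 0 ∷ # 4 ∷ # 3 ∷ # 2 ∷ # 1 ∷ []
o₃  = # 6 ∷ # 5 ∷ # 4 ∷ # 0 ∷ # 3 ∷ # 2 ∷ # 1 ∷ []
o₄  = # 6 ∷ # 5 ∷ # 4 ∷ # 3 ∷ # 0 ∷ # 2 ∷ # 1 ∷ []
o₅  = # 6 ∷ # 5 ∷ # 4 ∷ # 3 ∷ # 2 ∷ # 0 ∷ # 1 ∷ []
o₆  = # 6 ∷ # 5 ∷ # 4 ∷ # 3 ∷ # 2 ∷ # 1 ∷ # 0 ∷ []
o₇  = # 5 ∷ # 4 ∷ # 3 ∷ # 2 ∷ # 1 ∷ # 0 ∷ # 6 ∷ []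
o₈  = # 4 ∷ # 3 ∷ # 2 ∷ # 1 ∷ # 0 ∷ # 5 ∷ # 6 ∷ []
o₉  = # 3 ∷ # 2 ∷ # 1 ∷ # 0 ∷ # 4 ∷ # 5 ∷ # 6 ∷ []
o₁₀ = # 2 ∷ # 1 ∷ # 0 ∷ # 3 ∷ # 4 ∷ # 5 ∷ # 6 ∷ []
o₁₁ = # 1 ∷ # 0 ∷ # 2 ∷ # 3 ∷ # 4 ∷ # 5 ∷ # 6 ∷ []
o₁₂ = # 0 ∷ # 1 ∷ # 2 ∷ # 3 ∷ # 4 ∷ # 5 ∷ # 6 ∷ []

flip-path-of-length-12 : Σ[ ps ∈ List (Fin 7 × Fin 7) ] (FlipSeq S h₁ h₂ ps × length ps ≡ 12)
flip-path-of-length-12 = _ ,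
  ( checked-step h₁            (induced o₁)  o₀  o₁  (# 6) (# 0) (inj₁ (# 5))
  $ checked-step (induced o₁)  (induced o₂)  o₁  o₂  (# 5) (# 0) (inj₁ (# 4))
  $ checked-step (induced o₂)  (induced o₃)  o₂  o₃  (# 4) (# 0) (inj₁ (# 3))
  $ checked-step (induced o₃)  (induced o₄)  o₃  o₄  (# 3) (# 0) (inj₁ (# 2))
  $ checked-step (induced o₄)  (induced o₅)  o₄  o₅  (# 2) (# 0) (inj₁ (# 1))
  $ checked-step (induced o₅)  (induced o₆)  o₅  o₆  (# 1) (# 0) (inj₁ (# 0))
  $ checked-step (induced o₆)  (induced o₇)  o₆  o₇  (# 0) (# 6) (inj₁ (# 5))
  $ checked-step (induced o₇)  (induced o₈)  o₇  o₈  (# 0) (# 5) (inj₁ (# 4))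
  $ checked-step (induced o₈)  (induced o₉)  o₈  o₉  (# 0) (# 4) (inj₁ (# 3))
  $ checked-step (induced o₉)  (induced o₁₀) o₉  o₁₀ (# 0) (# 3) (inj₁ (# 2))
  $ checked-step (induced o₁₀) (induced o₁₁) o₁₀ o₁₁ (# 0) (# 2) (inj₁ (# 1))
  $ checked-step (induced o₁₁) h₂            o₁₁ o₁₂ (# 0) (# 1) (inj₁ (# 0))
  $ done (checked-acyclic h₂ o₁₂)
  ) , refl

lemma5 : FlipDistance S h₁ h₂ 12
         × (∀ ps → FlipSeq S h₁ h₂ ps → All Avoids0 ps → 15 ≤ length ps)
lemma5 =
    (flip-path-of-length-12 , λ ps seq → ≤-trans (minTotal≥12 (touched ps)) (minTotal≤length seq))
  , λ ps seq avoids →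
      ≤-trans (≤-reflexive (sym (minTotal-untouched (untouched-if-avoids0 avoids)))) (minTotal≤length seq)
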